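{- Let $m\geq 0$ and $r\geq 2$ be integers and let $\mathcal{B}$ be a choice on $[m]$. Then $$\operatorname{forb}(m,r,\mathcal{B})=\sum_{X\subseteq[m]}c(\mathcal{B},X)(r-2)^{m-|X|},$$ with the convention $0^0=1$.
   Context: For $|T|=3$ and $x\in T$, $e_x\in\{0,1\}^T$ has a 1 at $x$ and 0 elsewhere, $\bar e_x=\mathbf 1-e_x$. A choice on $[m]$ is a family $\mathcal{B}=(B_T)_{T\in\binom{[m]}{3}}$ where each $B_T\subseteq\{0,1\}^T$ contains exactly one vector from each pair $\{e_x,\bar e_x\}$, $x\in T$. $\operatorname{forb}(m,r,\mathcal{B})$ is the maximum number of columns of a simple (pairwise distinct columns) $m$-rowed matrix with entries in $\{0,\dots,r-1\}$ such that for every column $c$ and every $T\in\binom{[m]}{3}$, $c|_T\notin B_T$. For $X\subseteq[m]$, $c(\mathcal{B},X)$ is the number of vectors $u\in\{0,1\}^X$ such that $u|_T\notin B_T$ for every 3-subset $T\subseteq X$. -}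

module Defs where

open import Data.Nat using (ℕ; zero; suc; _+_; _*_; _∸_; _^_; _≤_)
open import Data.Bool using (Bool; true; false; not; _∧_; _∨_; T?)
open import Data.Fin using (Fin; zero; suc; toℕ; _<_; _<?_)
open import Data.Fin.Subset using (Subset; _∈_; ∣_∣)
open import Data.Vec using (Vec; []; _∷_; lookup; tabulate; map; replicate)
open import Data.List using (List; []; _∷_; length; filter; concatMap; _++_)
open import Data.Bool.ListAction using (all)
open import Data.Nat.ListAction using (sum)
import Data.List as L
open import Data.List.Relation.Unary.All using (All)
open import Data.List.Relation.Unary.Unique.Propositional using (Unique)
open import Data.Product using (Σ; ∃; _×_; _,_)
open import Data.Sum using (_⊎_)
open import Relation.Nullary using (¬_; yes; no; does)
open import Relation.Binary.PropositionalEquality using (_≡_)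

-- A 3-subset T = {i, j, k} of [m] = Fin m, listed increasingly i < j < k.
record Triple (m : ℕ) : Set where
  constructor triple
  field
    i j k : Fin m
    i<j : i < j
    j<k : j < k
open Triple public

-- A vector in {0,1}^T is a Vec Bool 3, coordinate p ∈ Fin 3 corresponding
-- to the p-th element (in increasing order) of T.
-- e_x (one at position p, zero elsewhere) and its complement.
e : Fin 3 → Vec Bool 3
e p = tabulate (λ q → does (Data.Fin._≟_ p q))

ebar : Fin 3 → Vec Bool 3
ebar p = map not (e p)

Family : ℕ → Set
Family m = Triple m → Vec Bool 3 → Bool

-- B is a choice: each B_T consists of exactly one vector from each pair
-- {e_x, ebar_x}, x ∈ T, and of no other vector (i.e. not 000 nor 111).
IsChoice : {m : ℕ} → Family m → Set
IsChoice {m} B = (T : Triple m) →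
  ((p : Fin 3) →
     (B T (e p) ≡ true × B T (ebar p) ≡ false)
   ⊎ (B T (e p) ≡ false × B T (ebar p) ≡ true))
  × B T (replicate 3 false) ≡ false
  × B T (replicate 3 true) ≡ false

restrict : {A : Set} {m : ℕ} → Vec A m → Triple m → Vec A 3
restrict c T = lookup c (i T) ∷ lookup c (j T) ∷ lookup c (k T) ∷ []

bitℕ : Bool → ℕ
bitℕ false = 0
bitℕ true = 1

-- for a column with entries in {0,…,r-1}, c|_T ∈ B_T
-- (B_T ⊆ {0,1}^T, so c|_T must be a 0/1 vector u with u ∈ B_T)
RestrInB : {m r : ℕ} → Family m → Vec (Fin r) m → Triple m → Set
RestrInB B c T = ∃ λ (u : Vec Bool 3) →
  map toℕ (restrict c T) ≡ map bitℕ u × B T u ≡ true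

Avoids : {m r : ℕ} → Family m → Vec (Fin r) m → Set
Avoids {m} B c = (T : Triple m) → ¬ RestrInB B c T

-- A simple matrix is
-- a list of pairwise distinct columns (column order is irrelevant).
IsForb : (m r : ℕ) → Family m → ℕ → Set
IsForb m r B n =
  (∃ λ (A : List (Vec (Fin r) m)) → Unique A × All (Avoids B) A × length A ≡ n)
  × ((A : List (Vec (Fin r) m)) → Unique A → All (Avoids B) A → length A ≤ n)

allBoolVecs : (m : ℕ) → List (Vec Bool m)
allBoolVecs zero = [] ∷ []
allBoolVecs (suc m) = L.map (false ∷_) (allBoolVecs m) L.++ L.map (true ∷_) (allBoolVecs m)

allFinL : (m : ℕ) → List (Fin m)
allFinL zero = []
allFinL (suc m) = zero ∷ L.map suc (allFinL m)

allTriples : (m : ℕ) → List (Triple m)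
allTriples m = concatMap (λ a → concatMap (λ b → concatMap (λ c → mk a b c) (allFinL m)) (allFinL m)) (allFinL m)
  where
  mk : Fin m → Fin m → Fin m → List (Triple m)
  mk a b c with a <? b | b <? c
  ... | yes p | yes q = triple a b c p q ∷ []
  ... | _ | _ = []

_⊆ᵀ_ : {m : ℕ} → Triple m → Subset m → Bool
T ⊆ᵀ X = lookup X (i T) ∧ lookup X (j T) ∧ lookup X (k T)

-- vectors u ∈ {0,1}^X are represented by u ∈ {0,1}^m with u_y = 0 for y ∉ X
supportedIn : {m : ℕ} → Subset m → Vec Bool m → Bool
supportedIn {m} X u = all (λ y → not (lookup u y) ∨ lookup X y) (allFinL m)

goodOn : {m : ℕ} → Family m → Subset m → Vec Bool m → Bool
goodOn {m} B X u = all (λ T → not (T ⊆ᵀ X) ∨ not (B T (restrict u T))) (allTriples m)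

cnt : {m : ℕ} → Family m → Subset m → ℕ
cnt {m} B X = length (filter (λ u → T? (supportedIn X u ∧ goodOn B X u)) (allBoolVecs m))

-- Σ_{X ⊆ [m]} c(B,X) (r-2)^{m-|X|}   (Agda's _^_ has 0 ^ 0 = 1)
forbSum : (m r : ℕ) → Family m → ℕ
forbSum m r B = sum (L.map (λ X → cnt B X * (r ∸ 2) ^ (m ∸ ∣ X ∣)) (allBoolVecs m))

-- A column c ∈ {0,…,r-1}^m is determined by its binary support X = {x | c_x ∈ {0,1}}, the
-- 0/1 vector u = c|_X, and its entries in {2,…,r-1} outside X.  Every B_T consists of 0/1
-- vectors, so c|_T can only lie in B_T when T ⊆ X, and then c|_T = u|_T: whether c avoids B
-- depends only on (X, u), and holds iff u is one of the c(B, X) admissible vectors on X.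
-- Each pair (X, u) is the trace of exactly (r-2)^(m-|X|) columns, so the formula counts the
-- avoiding columns; a simple matrix avoiding B has pairwise distinct avoiding columns, hence
-- the matrix of all avoiding columns is the largest one.

module Submission where

open import Defs
import Algebra.Properties.CommutativeSemigroup as CommutativeSemigroupProperties
open import Data.Bool using (Bool; true; false; not; _∧_; _∨_; T; T?)
open import Data.Bool.ListAction using (and)
open import Data.Bool.Properties using (T-≡; T-∧)
open import Data.Fin using (Fin; zero; suc; toℕ; _<_; _<?_)
open import Data.Fin.Properties using (<-irrelevant; injective⇒≤)
open import Data.Fin.Subset using (Subset; ∣_∣)
open import Data.Fin.Subset.Properties using (∣p∣≤n)
open import Data.List using (List; []; _∷_; length; filter; map; concatMap; _++_;
  allFin; tabulate; cartesianProductWith)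
import Data.List as L
open import Data.List.Membership.Propositional using (_∈_; lose)
open import Data.List.Membership.Propositional.Properties
  using (∈-concatMap⁺; ∈-map⁺; ∈-allFin; ∈-cartesianProductWith⁺; ∈-filter⁺; ∈-lookup)
open import Data.List.Membership.Setoid.Properties using (index-injective)
open import Data.List.Properties using (length-++; map-++; map-∘; map-cong; map-tabulate;
  filter-++; filter-≐; filter-none)
open import Data.List.Relation.Binary.Subset.Propositional using (_⊆_)
open import Data.List.Relation.Unary.All as All using (All; [])
open import Data.List.Relation.Unary.All.Properties using (all⁺; all⁻; all-filter)
open import Data.List.Relation.Unary.Any as Any using (here; there)
open import Data.List.Relation.Unary.Unique.Propositional using (Unique)
import Data.List.Relation.Unary.Unique.Propositional.Properties as Unique
open import Data.List.Relation.Unary.AllPairs using ([]; _∷_)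
open import Data.Nat using (ℕ; zero; suc; _+_; _*_; _∸_; _^_; _≤_; z≤n; s≤s)
open import Data.Nat.ListAction using (sum)
open import Data.Nat.ListAction.Properties using (sum-++)
open import Data.Nat.Properties using (+-commutativeSemigroup; *-commutativeSemigroup;
  +-assoc; +-comm; +-identityʳ; *-zeroʳ; *-distribˡ-+; *-distribʳ-+; +-∸-assoc; ≤-trans; ≤-reflexive)
open import Data.Product using (_×_; _,_)
open import Data.Vec using (Vec; []; _∷_)
import Data.Vec as V
open import Data.Vec.Properties using (lookup-map; ∷-injective)
import Data.Vec.Relation.Unary.All as VAll
open import Function using (_∘_; _⇔_; mk⇔; Equivalence)
open import Relation.Binary.PropositionalEquality
open import Relation.Nullary using (¬_; yes; no; contradiction)

open Equivalence using (to; from)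
open CommutativeSemigroupProperties +-commutativeSemigroup using () renaming (interchange to +-interchange)
open CommutativeSemigroupProperties *-commutativeSemigroup using () renaming (x∙yz≈y∙xz to *-leftComm)

private
  variable
    A B′ C : Set

count : (A → Bool) → List A → ℕ
count p xs = length (filter (T? ∘ p) xs)

count-++ : (p : A → Bool) (xs ys : List A) → count p (xs ++ ys) ≡ count p xs + count p ys
count-++ p xs ys = trans (cong length (filter-++ (T? ∘ p) xs ys)) (length-++ (filter (T? ∘ p) xs))

count-map : (p : B′ → Bool) (f : A → B′) (xs : List A) → count p (map f xs) ≡ count (p ∘ f) xs
count-map p f [] = refl
count-map p f (x ∷ xs) with p (f x)
... | true = cong suc (count-map p f xs)
... | false = count-map p f xs

count-cong : {p q : A → Bool} → (∀ x → p x ≡ q x) → (xs : List A) → count p xs ≡ count q xs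
count-cong {p = p} {q} p≗q xs =
  cong length (filter-≐ (T? ∘ p) (T? ∘ q)
    ((λ {x} → subst T (p≗q x)) , λ {x} → subst T (sym (p≗q x))) xs)

count-false : (xs : List A) → count (λ _ → false) xs ≡ 0
count-false xs = cong length (filter-none (T? ∘ λ _ → false) (All.universal (λ _ ()) xs))

count-cartesianProductWith : (p : B′ → Bool) (f : A → C → B′) (xs : List A) (ys : List C) →
  count p (cartesianProductWith f xs ys) ≡ sum (map (λ x → count (p ∘ f x) ys) xs)
count-cartesianProductWith p f [] ys = refl
count-cartesianProductWith p f (x ∷ xs) ys =
  trans (count-++ p (map (f x) ys) _)
        (cong₂ _+_ (count-map p (f x) ys) (count-cartesianProductWith p f xs ys))

sum-map-+ : (f g : A → ℕ) (xs : List A) →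
  sum (map (λ x → f x + g x) xs) ≡ sum (map f xs) + sum (map g xs)
sum-map-+ f g [] = refl
sum-map-+ f g (x ∷ xs) =
  trans (cong (f x + g x +_) (sum-map-+ f g xs)) (+-interchange (f x) (g x) _ _)

sum-map-*ˡ : (k : ℕ) (f : A → ℕ) (xs : List A) → sum (map (λ x → k * f x) xs) ≡ k * sum (map f xs)
sum-map-*ˡ k f [] = sym (*-zeroʳ k)
sum-map-*ˡ k f (x ∷ xs) =
  trans (cong (k * f x +_) (sum-map-*ˡ k f xs)) (sym (*-distribˡ-+ k (f x) _))

sum-tabulate-const : (n k : ℕ) → sum (tabulate {n = n} (λ _ → k)) ≡ n * k
sum-tabulate-const zero k = refl
sum-tabulate-const (suc n) k = cong (k +_) (sum-tabulate-const n k)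

∈-allFinL : ∀ {m} (y : Fin m) → y ∈ allFinL m
∈-allFinL zero = here refl
∈-allFinL (suc y) = there (∈-map⁺ suc (∈-allFinL y))

module _ {m : ℕ} where
  private
    -- allTriples is built from a helper local to Defs; unification against allTriples names it.
    innerOf : {f : Fin m → Fin m → Fin m → List (Triple m)} →
      allTriples m ≡
        concatMap (λ a → concatMap (λ b → concatMap (f a b) (allFinL m)) (allFinL m)) (allFinL m) →
      Fin m → Fin m → Fin m → List (Triple m)
    innerOf {f} _ = f

    triplesAt : Fin m → Fin m → Fin m → List (Triple m)
    triplesAt = innerOf refl

    ∈-triplesAt : ∀ a b c (a<b : a < b) (b<c : b < c) → triple a b c a<b b<c ∈ triplesAt a b c
    ∈-triplesAt a b c a<b b<c with a <? b | b <? c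
    ... | yes a<b′ | yes b<c′ rewrite <-irrelevant a<b a<b′ | <-irrelevant b<c b<c′ = here refl
    ... | no a≮b | _ = contradiction a<b a≮b
    ... | yes _ | no b≮c = contradiction b<c b≮c

  ∈-allTriples : (t : Triple m) → t ∈ allTriples m
  ∈-allTriples (triple a b c a<b b<c) =
    ∈-concatMap⁺ _ (lose (∈-allFinL a)
      (∈-concatMap⁺ _ (lose (∈-allFinL b)
        (∈-concatMap⁺ _ (lose (∈-allFinL c) (∈-triplesAt a b c a<b b<c))))))

columns : (r m : ℕ) → List (Vec (Fin r) m)
columns r zero = [] ∷ []
columns r (suc m) = cartesianProductWith _∷_ (allFin r) (columns r m)

∈-columns : ∀ {r m} (c : Vec (Fin r) m) → c ∈ columns r m
∈-columns [] = here refl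
∈-columns (a ∷ c) = ∈-cartesianProductWith⁺ _∷_ (∈-allFin a) (∈-columns c)

columns-unique : ∀ r m → Unique (columns r m)
columns-unique r zero = [] ∷ []
columns-unique r (suc m) =
  Unique.cartesianProductWith⁺ _∷_ ∷-injective (Unique.allFin⁺ r) (columns-unique r m)

lookup-injective : {xs : List A} → Unique xs → ∀ i j → L.lookup xs i ≡ L.lookup xs j → i ≡ j
lookup-injective (_ ∷ _) zero zero _ = refl
lookup-injective (x∉xs ∷ _) zero (suc j) eq = contradiction eq (All.lookup x∉xs (∈-lookup j))
lookup-injective (x∉xs ∷ _) (suc i) zero eq = contradiction (sym eq) (All.lookup x∉xs (∈-lookup i))
lookup-injective (_ ∷ xs!) (suc i) (suc j) eq = cong suc (lookup-injective xs! i j eq)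

Unique⇒length≤ : {xs ys : List A} → Unique xs → xs ⊆ ys → length xs ≤ length ys
Unique⇒length≤ {xs = xs} {ys} xs! xs⊆ys = injective⇒≤ injective
  where
  position : Fin (length xs) → Fin (length ys)
  position i = Any.index (xs⊆ys (∈-lookup i))
  injective : ∀ {i j} → position i ≡ position j → i ≡ j
  injective {i} {j} eq = lookup-injective xs! i j
    (index-injective (setoid _) (xs⊆ys (∈-lookup i)) (xs⊆ys (∈-lookup j)) eq)

-- The binary trace of a column

isBinary : ∀ {r} → Fin r → Bool
isBinary zero = true
isBinary (suc zero) = true
isBinary (suc (suc _)) = false

isOne : ∀ {r} → Fin r → Bool
isOne zero = false
isOne (suc zero) = true
isOne (suc (suc _)) = false

binarySupport : ∀ {r m} → Vec (Fin r) m → Subset m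
binarySupport = V.map isBinary

onesOf : ∀ {r m} → Vec (Fin r) m → Vec Bool m
onesOf = V.map isOne

toℕ≡bitℕ⇔ : ∀ {r} (a : Fin r) (b : Bool) → toℕ a ≡ bitℕ b ⇔ (T (isBinary a) × isOne a ≡ b)
toℕ≡bitℕ⇔ zero false = mk⇔ (λ _ → _ , refl) (λ _ → refl)
toℕ≡bitℕ⇔ zero true = mk⇔ (λ ()) (λ ())
toℕ≡bitℕ⇔ (suc zero) false = mk⇔ (λ ()) (λ ())
toℕ≡bitℕ⇔ (suc zero) true = mk⇔ (λ _ → _ , refl) (λ _ → refl)
toℕ≡bitℕ⇔ (suc (suc _)) false = mk⇔ (λ ()) (λ ())
toℕ≡bitℕ⇔ (suc (suc _)) true = mk⇔ (λ ()) (λ ())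

map-toℕ≡map-bitℕ⇔ : ∀ {r n} (w : Vec (Fin r) n) (u : Vec Bool n) →
  V.map toℕ w ≡ V.map bitℕ u ⇔ (VAll.All T (binarySupport w) × onesOf w ≡ u)
map-toℕ≡map-bitℕ⇔ [] [] = mk⇔ (λ _ → VAll.[] , refl) (λ _ → refl)
map-toℕ≡map-bitℕ⇔ (a ∷ w) (b ∷ u) = mk⇔ ⇒ ⇐
  where
  ⇒ : V.map toℕ (a ∷ w) ≡ V.map bitℕ (b ∷ u) →
      VAll.All T (binarySupport (a ∷ w)) × onesOf (a ∷ w) ≡ b ∷ u
  ⇒ eq with ∷-injective eq
  ... | head≡ , tail≡ with toℕ≡bitℕ⇔ a b .to head≡ | map-toℕ≡map-bitℕ⇔ w u .to tail≡
  ...   | a-bin , a-one | w-bin , w-ones = a-bin VAll.∷ w-bin , cong₂ _∷_ a-one w-ones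
  ⇐ : VAll.All T (binarySupport (a ∷ w)) × onesOf (a ∷ w) ≡ b ∷ u →
      V.map toℕ (a ∷ w) ≡ V.map bitℕ (b ∷ u)
  ⇐ (a-bin VAll.∷ w-bin , ones≡) with ∷-injective ones≡
  ... | a-one , w-ones =
    cong₂ _∷_ (toℕ≡bitℕ⇔ a b .from (a-bin , a-one)) (map-toℕ≡map-bitℕ⇔ w u .from (w-bin , w-ones))

restrict-map : ∀ {m} (f : A → B′) (c : Vec A m) (t : Triple m) →
  restrict (V.map f c) t ≡ V.map f (restrict c t)
restrict-map f c t rewrite lookup-map (i t) f c | lookup-map (j t) f c | lookup-map (k t) f c = refl

T-⊆ᵀ⇔ : ∀ {m} (t : Triple m) (X : Subset m) → T (t ⊆ᵀ X) ⇔ VAll.All T (restrict X t)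
T-⊆ᵀ⇔ t X = mk⇔ ⇒ ⇐
  where
  ⇒ : T (t ⊆ᵀ X) → VAll.All T (restrict X t)
  ⇒ t⊆X with T-∧ .to t⊆X
  ... | i∈X , jk⊆X with T-∧ .to jk⊆X
  ...   | j∈X , k∈X = i∈X VAll.∷ j∈X VAll.∷ k∈X VAll.∷ VAll.[]
  ⇐ : VAll.All T (restrict X t) → T (t ⊆ᵀ X)
  ⇐ (i∈X VAll.∷ j∈X VAll.∷ k∈X VAll.∷ VAll.[]) = T-∧ .from (i∈X , T-∧ .from (j∈X , k∈X))

RestrInB⇔ : ∀ {m r} (B : Family m) (c : Vec (Fin r) m) (t : Triple m) →
  RestrInB B c t ⇔ (T (t ⊆ᵀ binarySupport c) × T (B t (restrict (onesOf c) t)))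
RestrInB⇔ B c t = mk⇔ ⇒ ⇐
  where
  ⇒ : RestrInB B c t → T (t ⊆ᵀ binarySupport c) × T (B t (restrict (onesOf c) t))
  ⇒ (u , eq , u∈B) with map-toℕ≡map-bitℕ⇔ (restrict c t) u .to eq
  ... | binary , ones≡u =
    T-⊆ᵀ⇔ t (binarySupport c) .from (subst (VAll.All T) (sym (restrict-map isBinary c t)) binary) ,
    T-≡ .from (subst (λ v → B t v ≡ true) (sym (trans (restrict-map isOne c t) ones≡u)) u∈B)
  ⇐ : T (t ⊆ᵀ binarySupport c) × T (B t (restrict (onesOf c) t)) → RestrInB B c t
  ⇐ (t⊆X , u∈B) = restrict (onesOf c) t ,
    map-toℕ≡map-bitℕ⇔ (restrict c t) _ .from
      (subst (VAll.All T) (restrict-map isBinary c t) (T-⊆ᵀ⇔ t (binarySupport c) .to t⊆X) ,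
       sym (restrict-map isOne c t)) ,
    T-≡ .to u∈B

T-not∨not⇔ : (a b : Bool) → T (not a ∨ not b) ⇔ (¬ (T a × T b))
T-not∨not⇔ false _ = mk⇔ (λ _ ()) _
T-not∨not⇔ true false = mk⇔ (λ _ ()) _
T-not∨not⇔ true true = mk⇔ (λ ()) (λ ¬both → ¬both _)

Avoids⇔goodOn : ∀ {m r} (B : Family m) (c : Vec (Fin r) m) →
  Avoids B c ⇔ T (goodOn B (binarySupport c) (onesOf c))
Avoids⇔goodOn {m} B c = mk⇔
  (λ avoids → all⁻ _ {allTriples m} (All.tabulate λ {t} _ →
     T-not∨not⇔ _ _ .from (avoids t ∘ RestrInB⇔ B c t .from)))
  (λ good t → T-not∨not⇔ _ _ .to (All.lookup (all⁺ _ (allTriples m) good) (∈-allTriples t))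
                ∘ RestrInB⇔ B c t .to)

-- Counting columns by their binary trace

TracePredicate : ℕ → Set
TracePredicate m = Subset m → Vec Bool m → Bool

fixHead : ∀ {m} → Bool → Bool → TracePredicate (suc m) → TracePredicate m
fixHead x a G X u = G (x ∷ X) (a ∷ u)

columnCount : (s m : ℕ) → TracePredicate m → ℕ
columnCount s m G = count (λ c → G (binarySupport c) (onesOf c)) (columns (2 + s) m)

fibre : ∀ {m} → TracePredicate m → Subset m → ℕ
fibre {m} G X = count (λ u → supportedIn X u ∧ G X u) (allBoolVecs m)

fibreSum : (s m : ℕ) → TracePredicate m → ℕ
fibreSum s m G = sum (map (λ X → fibre G X * s ^ (m ∸ ∣ X ∣)) (allBoolVecs m))

columnCount-suc : ∀ s m (G : TracePredicate (suc m)) →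
  columnCount s (suc m) G ≡
    columnCount s m (fixHead true false G) +
    (columnCount s m (fixHead true true G) + s * columnCount s m (fixHead false false G))
columnCount-suc s m G = begin
  columnCount s (suc m) G
    ≡⟨ count-cartesianProductWith _ _∷_ (allFin (2 + s)) (columns (2 + s) m) ⟩
  sum (map byHead (allFin (2 + s)))
    ≡⟨ cong (λ xs → byHead zero + (byHead (suc zero) + sum xs))
            (map-tabulate {n = s} (λ a → suc (suc a)) byHead) ⟩
  byHead zero + (byHead (suc zero) + sum (tabulate {n = s} (λ _ → columnCount s m (fixHead false false G))))
    ≡⟨ cong (λ n → byHead zero + (byHead (suc zero) + n)) (sum-tabulate-const s _) ⟩
  columnCount s m (fixHead true false G) +
    (columnCount s m (fixHead true true G) + s * columnCount s m (fixHead false false G)) ∎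
  where
  open ≡-Reasoning
  byHead : Fin (2 + s) → ℕ
  byHead a = count (λ c → G (binarySupport (a ∷ c)) (onesOf (a ∷ c))) (columns (2 + s) m)

count-allBoolVecs-suc : ∀ {m} (p : Vec Bool (suc m) → Bool) →
  count p (allBoolVecs (suc m)) ≡
    count (p ∘ (false ∷_)) (allBoolVecs m) + count (p ∘ (true ∷_)) (allBoolVecs m)
count-allBoolVecs-suc {m} p =
  trans (count-++ p (map (false ∷_) (allBoolVecs m)) _)
        (cong₂ _+_ (count-map p _ (allBoolVecs m)) (count-map p _ (allBoolVecs m)))

sum-allBoolVecs-suc : ∀ {m} (f : Vec Bool (suc m) → ℕ) →
  sum (map f (allBoolVecs (suc m))) ≡
    sum (map (f ∘ (false ∷_)) (allBoolVecs m)) + sum (map (f ∘ (true ∷_)) (allBoolVecs m))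
sum-allBoolVecs-suc {m} f =
  trans (cong sum (map-++ f (map (false ∷_) (allBoolVecs m)) _))
        (trans (sum-++ (map f (map (false ∷_) (allBoolVecs m))) _)
               (sym (cong₂ _+_ (cong sum (map-∘ (allBoolVecs m))) (cong sum (map-∘ (allBoolVecs m))))))

supportedIn-∷ : ∀ {m} x (X : Subset m) a (u : Vec Bool m) →
  supportedIn (x ∷ X) (a ∷ u) ≡ (not a ∨ x) ∧ supportedIn X u
supportedIn-∷ {m} x X a u = cong (λ bs → (not a ∨ x) ∧ and bs) (sym (map-∘ (allFinL m)))

fibre-∷ : ∀ {m} (G : TracePredicate (suc m)) x (X : Subset m) →
  fibre G (x ∷ X) ≡
    fibre (fixHead x false G) X + count (λ u → (x ∧ supportedIn X u) ∧ G (x ∷ X) (true ∷ u)) (allBoolVecs m)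
fibre-∷ {m} G x X =
  trans (count-allBoolVecs-suc {m} (λ u → supportedIn (x ∷ X) u ∧ G (x ∷ X) u)) (cong₂ _+_
  (count-cong (λ u → cong (_∧ G (x ∷ X) (false ∷ u)) (supportedIn-∷ x X false u)) (allBoolVecs m))
  (count-cong (λ u → cong (_∧ G (x ∷ X) (true ∷ u)) (supportedIn-∷ x X true u)) (allBoolVecs m)))

fibreSum-suc : ∀ s m (G : TracePredicate (suc m)) →
  fibreSum s (suc m) G ≡
    fibreSum s m (fixHead true false G) +
    (fibreSum s m (fixHead true true G) + s * fibreSum s m (fixHead false false G))
fibreSum-suc s m G = begin
  fibreSum s (suc m) G
    ≡⟨ sum-allBoolVecs-suc {m} (λ X → fibre G X * s ^ (suc m ∸ ∣ X ∣)) ⟩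
  sum (map (λ X → fibre G (false ∷ X) * s ^ (suc m ∸ ∣ X ∣)) V) +
  sum (map (λ X → fibre G (true ∷ X) * weight X) V)
    ≡⟨ cong₂ _+_ (cong sum (map-cong outside V)) (cong sum (map-cong inside V)) ⟩
  sum (map (λ X → s * (fibre G₂ X * weight X)) V) +
  sum (map (λ X → fibre G₀ X * weight X + fibre G₁ X * weight X) V)
    ≡⟨ cong₂ _+_ (sum-map-*ˡ s _ V) (sum-map-+ _ _ V) ⟩
  s * fibreSum s m G₂ + (fibreSum s m G₀ + fibreSum s m G₁)
    ≡⟨ +-comm (s * fibreSum s m G₂) _ ⟩
  (fibreSum s m G₀ + fibreSum s m G₁) + s * fibreSum s m G₂
    ≡⟨ +-assoc (fibreSum s m G₀) _ _ ⟩
  fibreSum s m G₀ + (fibreSum s m G₁ + s * fibreSum s m G₂) ∎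
  where
  open ≡-Reasoning
  V = allBoolVecs m
  G₀ G₁ G₂ : TracePredicate m
  G₀ = fixHead true false G
  G₁ = fixHead true true G
  G₂ = fixHead false false G
  weight : Subset m → ℕ
  weight X = s ^ (m ∸ ∣ X ∣)
  outside : ∀ X → fibre G (false ∷ X) * s ^ (suc m ∸ ∣ X ∣) ≡ s * (fibre G₂ X * weight X)
  outside X = trans
    (cong₂ _*_ (trans (fibre-∷ G false X) (trans (cong (fibre G₂ X +_) (count-false V)) (+-identityʳ _)))
               (cong (s ^_) (+-∸-assoc 1 (∣p∣≤n X))))
    (*-leftComm (fibre G₂ X) s (weight X))
  inside : ∀ X → fibre G (true ∷ X) * weight X ≡ fibre G₀ X * weight X + fibre G₁ X * weight X
  inside X = trans (cong (_* weight X) (fibre-∷ G true X)) (*-distribʳ-+ (weight X) (fibre G₀ X) _)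

columnCount≡fibreSum : ∀ s m (G : TracePredicate m) → columnCount s m G ≡ fibreSum s m G
columnCount≡fibreSum s zero G with G [] []
... | true = refl
... | false = refl
columnCount≡fibreSum s (suc m) G = begin
  columnCount s (suc m) G
    ≡⟨ columnCount-suc s m G ⟩
  columnCount s m (fixHead true false G) +
    (columnCount s m (fixHead true true G) + s * columnCount s m (fixHead false false G))
    ≡⟨ cong₂ _+_ (columnCount≡fibreSum s m _)
                 (cong₂ _+_ (columnCount≡fibreSum s m _) (cong (s *_) (columnCount≡fibreSum s m _))) ⟩
  fibreSum s m (fixHead true false G) +
    (fibreSum s m (fixHead true true G) + s * fibreSum s m (fixHead false false G))
    ≡⟨ fibreSum-suc s m G ⟨
  fibreSum s (suc m) G ∎
  where open ≡-Reasoning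

lemma2p3 : (m r : ℕ) → 2 ≤ r → (B : Family m) → IsChoice B →
    IsForb m r B (forbSum m r B)
lemma2p3 m (suc (suc s)) (s≤s (s≤s z≤n)) B _ =
  (avoiding , Unique.filter⁺ _ (columns-unique _ m) , avoiding-avoid , length-avoiding) , maximal
  where
  good : Vec (Fin (2 + s)) m → Bool
  good c = goodOn B (binarySupport c) (onesOf c)

  avoiding : List (Vec (Fin (2 + s)) m)
  avoiding = filter (T? ∘ good) (columns _ m)

  avoiding-avoid : All (Avoids B) avoiding
  avoiding-avoid = All.map (λ {c} → Avoids⇔goodOn B c .from) (all-filter (T? ∘ good) (columns _ m))

  length-avoiding : length avoiding ≡ forbSum m (2 + s) B
  length-avoiding = columnCount≡fibreSum s m (goodOn B)

  maximal : (A : List (Vec (Fin (2 + s)) m)) → Unique A → All (Avoids B) A → length A ≤ forbSum m (2 + s) B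
  maximal A A! A-avoid = ≤-trans (Unique⇒length≤ A! A⊆avoiding) (≤-reflexive length-avoiding)
    where
    A⊆avoiding : A ⊆ avoiding
    A⊆avoiding {c} c∈A =
      ∈-filter⁺ (T? ∘ good) (∈-columns c) (Avoids⇔goodOn B c .to (All.lookup A-avoid c∈A))
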